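{- There exists a $2$-round algorithm which achieves a $4$-approximation in the problem of parallel approximate maximum selection with adversarial comparators on $k$ items. The algorithm requires $O(k^{4/3})$ queries.
   Context: Adversarial comparator model: there are $k$ items with unknown real values $x_1,\dots,x_k$. A query (comparison) of a pair of items $i,j$ is answered by a comparator which returns the item with the larger value if $|x_i-x_j|>1$, and returns either $i$ or $j$ (chosen adversarially, possibly adaptively depending on previous queries) if $|x_i-x_j|\le 1$. Parallel setting with $t$ rounds: in round $r$ the algorithm simultaneously submits a set of $m_r$ pairs (chosen based on answers from earlier rounds) and then simultaneously receives all $m_r$ answers; the query complexity is $\sum_r m_r$. A value $x$ is a $\tau$-approximation of the maximum if $x\ge \max_i x_i-\tau$; an algorithm achieves a $\tau$-approximation if it outputs an item whose value is a $\tau$-approximation of the maximum, for all values and all adversarial comparators.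
   Formalization: The unknown item values $x_1,\dots,x_k$ are rational instead of real. -}

module Defs where

open import Data.Nat using (ℕ; suc; _+_; _*_; _^_; _≤_)
open import Data.Fin using (Fin)
open import Data.Bool using (Bool; true; false)
open import Data.Product using (_×_; _,_)
open import Data.List using (List; length)
open import Data.List.Relation.Binary.Pointwise using (Pointwise)
open import Data.Integer using (+_)
import Data.Rational as ℚ
open ℚ using (ℚ)
open import Relation.Binary.PropositionalEquality using (_≡_)

-- A query is an ordered pair (i , j) of items; an answer is a Bool:
-- true means the comparator returned i, false means it returned j.
Query : ℕ → Set
Query k = Fin k × Fin k

record TwoRoundAlg (k : ℕ) : Set where
  field
    round1 : List (Query k)
    round2 : List Bool → List (Query k)
    output : List Bool → List Bool → Fin k
open TwoRoundAlg public

ValidAnswer : ∀ {k} → (Fin k → ℚ) → Query k → Bool → Set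
ValidAnswer x (i , j) b =
  (x i ℚ.+ ℚ.1ℚ ℚ.< x j → b ≡ false) × (x j ℚ.+ ℚ.1ℚ ℚ.< x i → b ≡ true)

ValidAnswers : ∀ {k} → (Fin k → ℚ) → List (Query k) → List Bool → Set
ValidAnswers x qs as = Pointwise (ValidAnswer x) qs as

IsApproxMax : ∀ {k} → ℚ → (Fin k → ℚ) → ℚ → Set
IsApproxMax τ x v = ∀ i → x i ℚ.≤ v ℚ.+ τ

Achieves : ∀ {k} → ℚ → TwoRoundAlg k → Set
Achieves {k} τ A =
  (x : Fin k → ℚ) (a₁ a₂ : List Bool) →
  ValidAnswers x (round1 A) a₁ →
  ValidAnswers x (round2 A a₁) a₂ →
  IsApproxMax τ x (x (output A a₁ a₂))

QueriesAtMost : ∀ {k} → TwoRoundAlg k → ℕ → Set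
QueriesAtMost {k} A q =
  (x : Fin k → ℚ) (a₁ : List Bool) →
  ValidAnswers x (round1 A) a₁ →
  length (round1 A) + length (round2 A a₁) ≤ q

four : ℚ
four = + 4 ℚ./ 1

-- Split the k items into s² groups of s items, where k ≤ s³ ≤ 8k (items are
-- repeated to fill the slots).  Round 1 compares all pairs inside every group,
-- round 2 all pairs among the s² group winners: s⁴ + s⁴ = O(k^{4/3}) queries.
-- In every round the winner is a king of the tournament given by the answers:
-- it reaches every other item in at most two steps, each step losing at most 1
-- in value.  So the winner of u's group is within 2 of u, and the output is
-- within 2 of that winner.
module Submission where

open import Defs
open import Data.Nat using (ℕ; zero; suc; _+_; _*_; _^_; _≤_; _<_; z≤n; s≤s; _≤?_)
open import Data.Nat.Properties
  using (≤-trans; ≤-reflexive; ≰⇒>; n≤1+n; n<1+n; +-monoˡ-≤; *-mono-≤; *-mono-<; *-monoʳ-≤; ^-monoˡ-≤; module ≤-Reasoning)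
open import Data.Nat.DivMod using (_mod_; m<n⇒m%n≡m)
open import Data.Nat.Solver using (module +-*-Solver)
open import Data.Fin as Fin using (Fin; toℕ; combine; inject≤)
open import Data.Fin.Properties using (fromℕ<-cong; fromℕ<-toℕ; toℕ<n; toℕ-inject≤; combine-surjective)
open import Data.Product using (Σ; _×_; _,_; proj₁; proj₂; ∃-syntax)
open import Data.Product.Properties using (≡-dec)
open import Data.Sum using (_⊎_; inj₁; inj₂; [_,_]′)
open import Data.Bool using (Bool; true; false)
import Data.Bool.Properties as Bool
open import Data.List using (List; []; _∷_; map; length; zip; concatMap; allFin; cartesianProduct)
open import Data.List.Properties using (length-++; length-map; length-tabulate)
open import Data.List.Relation.Unary.Any using (Any; here; there; any?; satisfied)
open import Data.List.Relation.Binary.Pointwise using (Pointwise; []; _∷_)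
open import Data.List.Relation.Binary.Subset.Propositional using (_⊆_)
open import Data.List.Membership.Propositional using (_∈_; find; lose)
open import Data.List.Membership.Propositional.Properties
  using (∈-map⁺; ∈-allFin; ∈-concat⁺′; ∈-cartesianProductWith⁺)
import Data.List.Membership.DecPropositional as DecMembership
open import Data.Rational as ℚ using (ℚ; 1ℚ)
import Data.Rational.Properties as ℚ
open import Function using (id)
open import Level using (0ℓ)
open import Relation.Binary using (Rel; Decidable)
open import Relation.Binary.PropositionalEquality using (_≡_; refl; trans; cong; cong₂; subst; module ≡-Reasoning)
open import Relation.Nullary using (¬_; yes; no; contradiction)
open import Relation.Nullary.Decidable using (_×-dec_; _⊎-dec_)

private
  variable
    A B : Set

allPairs : List A → List (A × A)
allPairs xs = cartesianProduct xs xs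

length-allPairs : (xs : List A) → length (allPairs xs) ≡ length xs * length xs
length-allPairs xs = go xs
  where
    go : (ys : List A) → length (cartesianProduct ys xs) ≡ length ys * length xs
    go []       = refl
    go (y ∷ ys) = trans (length-++ (map (y ,_) xs)) (cong₂ _+_ (length-map (y ,_) xs) (go ys))

∈-allPairs : {xs : List A} {a b : A} → a ∈ xs → b ∈ xs → (a , b) ∈ allPairs xs
∈-allPairs = ∈-cartesianProductWith⁺ _,_

length-concatMap-const : (f : A → List B) {c : ℕ} → (∀ a → length (f a) ≡ c) →
                         ∀ xs → length (concatMap f xs) ≡ length xs * c
length-concatMap-const f eq []       = refl
length-concatMap-const f eq (x ∷ xs) =
  trans (length-++ (f x)) (cong₂ _+_ (eq x) (length-concatMap-const f eq xs))

∈-concatMap : (f : A → List B) {a : A} {b : B} {xs : List A} → b ∈ f a → a ∈ xs → b ∈ concatMap f xs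
∈-concatMap f b∈fa a∈xs = ∈-concat⁺′ b∈fa (∈-map⁺ f a∈xs)

length-allFin : ∀ n → length (allFin n) ≡ n
length-allFin n = length-tabulate id

module _ {R : A → B → Set} where

  Pointwise-∈-zip : ∀ {xs ys x y} → Pointwise R xs ys → (x , y) ∈ zip xs ys → R x y
  Pointwise-∈-zip (r ∷ rs) (here refl) = r
  Pointwise-∈-zip (r ∷ rs) (there p)   = Pointwise-∈-zip rs p

  Pointwise-zip-partner : ∀ {xs ys x} → Pointwise R xs ys → x ∈ xs → ∃[ y ] (x , y) ∈ zip xs ys
  Pointwise-zip-partner (_∷_ {y = y} r rs) (here refl) = y , here refl
  Pointwise-zip-partner (r ∷ rs) (there p) =
    let y , p′ = Pointwise-zip-partner rs p in y , there p′

toℕ-mod : ∀ {n} (u : Fin (suc n)) → toℕ u mod suc n ≡ u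
toℕ-mod u = trans (fromℕ<-cong _ _ (m<n⇒m%n≡m (toℕ<n u)) _ (toℕ<n u)) (fromℕ<-toℕ u (toℕ<n u))

2ℚ : ℚ
2ℚ = 1ℚ ℚ.+ 1ℚ

module Tournament {_⇝_ : Rel A 0ℓ} (_⇝?_ : Decidable _⇝_) (G : List A) where

  _⇝²_ : Rel A 0ℓ
  w ⇝² u = Any (λ z → w ⇝ z × z ⇝ u) G

  _⇝²?_ : Decidable _⇝²_
  w ⇝²? u = any? (λ z → w ⇝? z ×-dec z ⇝? u) G

  champion : A → List A → A
  champion w []       = w
  champion w (u ∷ us) with champion u us ⇝²? w
  ... | yes _ = champion u us
  ... | no  _ = w

  king : A → List A → A
  king d []       = d
  king d (w ∷ us) = champion w us

  module _ (total : ∀ {a b} → a ∈ G → b ∈ G → a ⇝ b ⊎ b ⇝ a) where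

    ⇝²-refl : ∀ {a} → a ∈ G → a ⇝² a
    ⇝²-refl a∈ = let a⇝a = [ id , id ]′ (total a∈ a∈) in lose a∈ (a⇝a , a⇝a)

    -- Any z ∈ G with c ⇝ z has w ⇝ z, since z ⇝ w would give c ⇝² w.
    ⇝²-overtake : ∀ {c w v} → w ∈ G → ¬ c ⇝² w → c ⇝² v → w ⇝² v
    ⇝²-overtake w∈ c⇝̸²w c⇝²v =
      let z , z∈ , c⇝z , z⇝v = find c⇝²v
          w⇝z = [ (λ z⇝w → contradiction (lose z∈ (c⇝z , z⇝w)) c⇝̸²w) , id ]′ (total z∈ w∈)
      in lose z∈ (w⇝z , z⇝v)

    champion-⇝² : ∀ w us → w ∷ us ⊆ G → ∀ {v} → v ∈ w ∷ us → champion w us ⇝² v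
    champion-⇝² w []       sub (here refl) = ⇝²-refl (sub (here refl))
    champion-⇝² w (u ∷ us) sub v∈ with champion u us ⇝²? w | v∈
    ... | yes c⇝²w | here refl = c⇝²w
    ... | yes _    | there v∈′ = champion-⇝² u us (λ p → sub (there p)) v∈′
    ... | no  _    | here refl = ⇝²-refl (sub (here refl))
    ... | no  c⇝̸²w | there v∈′ =
      ⇝²-overtake (sub (here refl)) c⇝̸²w (champion-⇝² u us (λ p → sub (there p)) v∈′)

    king-⇝² : ∀ d {L} → L ⊆ G → ∀ {v} → v ∈ L → king d L ⇝² v
    king-⇝² d {w ∷ us} sub v∈ = champion-⇝² w us sub v∈

  ⇝²-≤ : (x : A → ℚ) → (∀ {a b} → a ⇝ b → x b ℚ.≤ x a ℚ.+ 1ℚ) →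
         ∀ {w u} → w ⇝² u → x u ℚ.≤ x w ℚ.+ 2ℚ
  ⇝²-≤ x step {w} {u} w⇝²u with satisfied w⇝²u
  ... | z , w⇝z , z⇝u = begin
    x u                ≤⟨ step z⇝u ⟩
    x z ℚ.+ 1ℚ         ≤⟨ ℚ.+-monoˡ-≤ 1ℚ (step w⇝z) ⟩
    x w ℚ.+ 1ℚ ℚ.+ 1ℚ  ≡⟨ ℚ.+-assoc (x w) 1ℚ 1ℚ ⟩
    x w ℚ.+ 2ℚ         ∎
    where open ℚ.≤-Reasoning

module Answers {k : ℕ} (qs : List (Query k)) (bs : List Bool) where

  Won : Rel (Fin k) 0ℓ
  Won a b = ((a , b) , true) ∈ zip qs bs ⊎ ((b , a) , false) ∈ zip qs bs

  won? : Decidable Won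
  won? a b = ((a , b) , true) ∈? zip qs bs ⊎-dec ((b , a) , false) ∈? zip qs bs
    where open DecMembership (≡-dec (≡-dec Fin._≟_ Fin._≟_) Bool._≟_)

  module _ (x : Fin k → ℚ) (valid : ValidAnswers x qs bs) where

    won⇒≤+1 : ∀ {a b} → Won a b → x b ℚ.≤ x a ℚ.+ 1ℚ
    won⇒≤+1 (inj₁ p) = ℚ.≮⇒≥ λ lt → contradiction (proj₁ (Pointwise-∈-zip valid p) lt) λ ()
    won⇒≤+1 (inj₂ p) = ℚ.≮⇒≥ λ lt → contradiction (proj₂ (Pointwise-∈-zip valid p) lt) λ ()

    won-total : ∀ {a b} → (a , b) ∈ qs → Won a b ⊎ Won b a
    won-total ab∈ with Pointwise-zip-partner valid ab∈
    ... | true  , p = inj₁ (inj₁ p)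
    ... | false , p = inj₂ (inj₂ p)

  best : Fin k → List (Fin k) → Fin k
  best d L = Tournament.king won? L d L

  best-approx : ∀ x → ValidAnswers x qs bs → ∀ d {L} → (∀ {a b} → a ∈ L → b ∈ L → (a , b) ∈ qs) →
                ∀ {v} → v ∈ L → x v ℚ.≤ x (best d L) ℚ.+ 2ℚ
  best-approx x valid d {L} queried v∈ =
    ⇝²-≤ x (won⇒≤+1 x valid) (king-⇝² (λ a∈ b∈ → won-total x valid (queried a∈ b∈)) d id v∈)
    where open Tournament won? L

cube : ℕ → ℕ
cube s = s * s * s

cube-mono-≤ : ∀ {a b} → a ≤ b → cube a ≤ cube b
cube-mono-≤ a≤b = *-mono-≤ (*-mono-≤ a≤b a≤b) a≤b

cube-mono-< : ∀ {a b} → a < b → cube a < cube b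
cube-mono-< a<b = *-mono-< (*-mono-< a<b a<b) a<b

cube-double : ∀ s → cube (s + s) ≡ 8 * cube s
cube-double = solve 1 (λ s → (s :+ s) :* (s :+ s) :* (s :+ s) := con 8 :* (s :* s :* s)) refl
  where open +-*-Solver

cube-suc-≤ : ∀ s → cube (suc s) ≤ 8 * suc (cube s)
cube-suc-≤ zero    = s≤s z≤n
cube-suc-≤ (suc s) = begin
  cube (2 + s)            ≤⟨ cube-mono-≤ {2 + s} {suc s + suc s} (+-monoˡ-≤ (suc s) (s≤s z≤n)) ⟩
  cube (suc s + suc s)    ≡⟨ cube-double (suc s) ⟩
  8 * cube (suc s)        ≤⟨ *-monoʳ-≤ 8 (n≤1+n (cube (suc s))) ⟩
  8 * suc (cube (suc s))  ∎
  where open ≤-Reasoning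

cube-root-bracket : ∀ k → ∃[ s ] k ≤ cube s × cube s ≤ 8 * k
cube-root-bracket zero = 0 , z≤n , z≤n
cube-root-bracket (suc k) with cube-root-bracket k
... | s , k≤s³ , s³≤8k with suc k ≤? cube s
...   | yes k<s³ = s , k<s³ , ≤-trans s³≤8k (*-monoʳ-≤ 8 (n≤1+n k))
...   | no  k≮s³ = suc s , ≤-trans (s≤s k≤s³) (cube-mono-< (n<1+n s))
                         , ≤-trans (cube-suc-≤ s) (*-monoʳ-≤ 8 (≰⇒> k≮s³))

queries-cubed-≤ : ∀ k s → cube s ≤ 8 * k → (s * s * (s * s) + s * s * (s * s)) ^ 3 ≤ 32768 * k ^ 4
queries-cubed-≤ k s s³≤8k = begin
  (s * s * (s * s) + s * s * (s * s)) ^ 3  ≡⟨ expand s ⟩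
  8 * cube s ^ 4                           ≤⟨ *-monoʳ-≤ 8 (^-monoˡ-≤ 4 s³≤8k) ⟩
  8 * (8 * k) ^ 4                          ≡⟨ collect k ⟩
  32768 * k ^ 4                            ∎
  where
    open ≤-Reasoning
    open +-*-Solver
    expand : ∀ s → (s * s * (s * s) + s * s * (s * s)) ^ 3 ≡ 8 * (s * s * s) ^ 4
    expand = solve 1 (λ s → (s :* s :* (s :* s) :+ s :* s :* (s :* s)) :^ 3 := con 8 :* (s :* s :* s) :^ 4) refl
    collect : ∀ k → 8 * (8 * k) ^ 4 ≡ 32768 * k ^ 4
    collect = solve 1 (λ k → con 8 :* (con 8 :* k) :^ 4 := con 32768 :* k :^ 4) refl

module TwoRoundKings {n : ℕ} (g s : ℕ) (k≤gs : suc n ≤ g * s) where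
  open Answers using (best; best-approx)

  -- the g * s slots are filled cyclically with the k items
  member : Fin g → Fin s → Fin (suc n)
  member j t = toℕ (combine j t) mod suc n

  group : Fin g → List (Fin (suc n))
  group j = map (member j) (allFin s)

  group-covers : ∀ u → ∃[ j ] u ∈ group j
  group-covers u with combine-surjective (inject≤ u k≤gs)
  ... | j , t , combine≡u = j , subst (_∈ group j) member≡u (∈-map⁺ (member j) (∈-allFin t))
    where
      open ≡-Reasoning
      member≡u : member j t ≡ u
      member≡u = begin
        toℕ (combine j t) mod suc n       ≡⟨ cong (λ i → toℕ i mod suc n) combine≡u ⟩
        toℕ (inject≤ u k≤gs) mod suc n    ≡⟨ cong (_mod suc n) (toℕ-inject≤ u k≤gs) ⟩
        toℕ u mod suc n                   ≡⟨ toℕ-mod u ⟩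
        u                                 ∎

  length-group : ∀ j → length (group j) ≡ s
  length-group j = trans (length-map (member j) (allFin s)) (length-allFin s)

  round₁ : List (Query (suc n))
  round₁ = concatMap (λ j → allPairs (group j)) (allFin g)

  winner : List Bool → Fin g → Fin (suc n)
  winner a₁ j = best round₁ a₁ Fin.zero (group j)

  finalists : List Bool → List (Fin (suc n))
  finalists a₁ = map (winner a₁) (allFin g)

  round₂ : List Bool → List (Query (suc n))
  round₂ a₁ = allPairs (finalists a₁)

  algorithm : TwoRoundAlg (suc n)
  algorithm = record
    { round1 = round₁
    ; round2 = round₂
    ; output = λ a₁ a₂ → best (round₂ a₁) a₂ Fin.zero (finalists a₁)
    }

  achieves-four : Achieves four algorithm
  achieves-four x a₁ a₂ valid₁ valid₂ u with group-covers u
  ... | j , u∈ = begin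
    x u                  ≤⟨ best-approx round₁ a₁ x valid₁ Fin.zero in-round₁ u∈ ⟩
    x w ℚ.+ 2ℚ           ≤⟨ ℚ.+-monoˡ-≤ 2ℚ (best-approx (round₂ a₁) a₂ x valid₂ Fin.zero ∈-allPairs w∈) ⟩
    x o ℚ.+ 2ℚ ℚ.+ 2ℚ    ≡⟨ ℚ.+-assoc (x o) 2ℚ 2ℚ ⟩
    x o ℚ.+ four         ∎
    where
      open ℚ.≤-Reasoning
      w = winner a₁ j
      o = output algorithm a₁ a₂
      in-round₁ : ∀ {a b} → a ∈ group j → b ∈ group j → (a , b) ∈ round₁
      in-round₁ a∈ b∈ = ∈-concatMap (λ j → allPairs (group j)) (∈-allPairs a∈ b∈) (∈-allFin j)
      w∈ : w ∈ finalists a₁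
      w∈ = ∈-map⁺ (winner a₁) (∈-allFin j)

  queries : QueriesAtMost algorithm (g * (s * s) + g * g)
  queries _ a₁ _ = ≤-reflexive (cong₂ _+_ length-round₁ length-round₂)
    where
      length-round₁ : length round₁ ≡ g * (s * s)
      length-round₁ = trans
        (length-concatMap-const (λ j → allPairs (group j))
          (λ j → trans (length-allPairs (group j)) (cong₂ _*_ (length-group j) (length-group j)))
          (allFin g))
        (cong (_* (s * s)) (length-allFin g))
      length-finalists : length (finalists a₁) ≡ g
      length-finalists = trans (length-map (winner a₁) (allFin g)) (length-allFin g)
      length-round₂ : length (round₂ a₁) ≡ g * g
      length-round₂ = trans (length-allPairs (finalists a₁)) (cong₂ _*_ length-finalists length-finalists)

theorem5p7 : Σ ℕ λ C → (n : ℕ) → Σ (TwoRoundAlg (suc n)) λ A →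
    Achieves four A × Σ ℕ λ q → QueriesAtMost A q × q ^ 3 ≤ C * suc n ^ 4
theorem5p7 = 32768 , λ n →
  let s , k≤s³ , s³≤8k = cube-root-bracket (suc n)
      open TwoRoundKings (s * s) s k≤s³
  in algorithm , achieves-four , _ , queries , queries-cubed-≤ (suc n) s s³≤8k
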